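{- (1) Let $(M,\sqcup,\sqcap)$ be a mixed lattice algebra, and define relations on $M$ by $x\sqsubseteq y \iff y\sqcap x=x$ and $x\leq y\iff x\sqcap y=x$. Then $\sqsubseteq$ and $\leq$ are partial orders, and $(M,\leq,\sqsubseteq)$ is an order-theoretic mixed lattice in which, for all $x,y\in M$, $x\leq y\iff y\,\overline{\vee}\,x=y\iff x\,\underline{\wedge}\,y=x$ (where $\overline{\vee},\underline{\wedge}$ denote the mixed envelopes of $(M,\leq,\sqsubseteq)$). (2) Conversely, if $(M,\leq,\sqsubseteq)$ is an order-theoretic mixed lattice such that $x\leq y\iff y\,\overline{\vee}\,x=y\iff x\,\underline{\wedge}\,y=x$ for all $x,y\in M$, then $(M,\overline{\vee},\underline{\wedge})$, with $\overline{\vee},\underline{\wedge}$ its mixed upper and lower envelopes, is a mixed lattice algebra.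
   Context: Order-theoretic mixed lattice: let $M$ be a set with two partial orderings $\leq$ and $\sqsubseteq$. The mixed upper envelope is $x\,\overline{\vee}\,y=\min\{w\in M: x\sqsubseteq w \text{ and } y\leq w\}$ and the mixed lower envelope is $x\,\underline{\wedge}\,y=\max\{w\in M: w\sqsubseteq x\text{ and } w\leq y\}$, min and max with respect to $\leq$; $(M,\leq,\sqsubseteq)$ is a mixed lattice if these exist for all $x,y\in M$. Mixed lattice algebra: an algebra $(M,\sqcup,\sqcap)$ with binary operations (not assumed commutative or associative) such that for all $x,y,z\in M$: (M1) $x\sqcup y=x\sqcap y \iff x=y$; (M2a) $(x\sqcap y)\sqcup x=x$ and $(x\sqcup y)\sqcap x=x$; (M2b) $x\sqcup(y\sqcap x)=x$ and $x\sqcap(y\sqcup x)=x$; (M3a) $z\sqcap(x\sqcup y)=[z\sqcap(x\sqcup y)]\sqcup(z\sqcap y)$; (M3b) $z\sqcup(x\sqcap y)=[z\sqcup(x\sqcap y)]\sqcap(z\sqcup y)$; (M4a) $(x\sqcup y)\sqcap z=[(x\sqcup y)\sqcap z]\sqcup(x\sqcap z)$; (M4b) $(x\sqcap y)\sqcup z=[(x\sqcap y)\sqcup z]\sqcap(x\sqcup z)$. -}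

module Defs where

open import Data.Product using (Σ; _×_; proj₁)
open import Relation.Binary.PropositionalEquality using (_≡_)
open import Relation.Binary.Structures using (IsPartialOrder)
open import Function.Bundles using (_⇔_)

record IsMixedLatticeAlgebra (M : Set) (_⊔_ _⊓_ : M → M → M) : Set where
  field
    M1  : ∀ x y → (x ⊔ y ≡ x ⊓ y) ⇔ (x ≡ y)
    M2a₁ : ∀ x y → (x ⊓ y) ⊔ x ≡ x
    M2a₂ : ∀ x y → (x ⊔ y) ⊓ x ≡ x
    M2b₁ : ∀ x y → x ⊔ (y ⊓ x) ≡ x
    M2b₂ : ∀ x y → x ⊓ (y ⊔ x) ≡ x
    M3a : ∀ x y z → z ⊓ (x ⊔ y) ≡ (z ⊓ (x ⊔ y)) ⊔ (z ⊓ y)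
    M3b : ∀ x y z → z ⊔ (x ⊓ y) ≡ (z ⊔ (x ⊓ y)) ⊓ (z ⊔ y)
    M4a : ∀ x y z → (x ⊔ y) ⊓ z ≡ ((x ⊔ y) ⊓ z) ⊔ (x ⊓ z)
    M4b : ∀ x y z → (x ⊓ y) ⊔ z ≡ ((x ⊓ y) ⊔ z) ⊓ (x ⊔ z)

algSqLe : {M : Set} → (M → M → M) → M → M → Set
algSqLe _⊓_ x y = y ⊓ x ≡ x

algLe : {M : Set} → (M → M → M) → M → M → Set
algLe _⊓_ x y = x ⊓ y ≡ x

IsUpperEnvelope : {M : Set} → (_≤_ _⊑_ : M → M → Set) → M → M → M → Set
IsUpperEnvelope _≤_ _⊑_ x y w =
  ((x ⊑ w) × (y ≤ w)) × (∀ v → x ⊑ v → y ≤ v → w ≤ v)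

IsLowerEnvelope : {M : Set} → (_≤_ _⊑_ : M → M → Set) → M → M → M → Set
IsLowerEnvelope _≤_ _⊑_ x y w =
  ((w ⊑ x) × (w ≤ y)) × (∀ v → v ⊑ x → v ≤ y → v ≤ w)

record IsMixedLattice (M : Set) (_≤_ _⊑_ : M → M → Set) : Set where
  field
    ≤-isPartialOrder : IsPartialOrder _≡_ _≤_
    ⊑-isPartialOrder : IsPartialOrder _≡_ _⊑_
    upper : ∀ x y → Σ M (IsUpperEnvelope _≤_ _⊑_ x y)
    lower : ∀ x y → Σ M (IsLowerEnvelope _≤_ _⊑_ x y)

  _∨̄_ : M → M → M
  x ∨̄ y = proj₁ (upper x y)

  _∧̲_ : M → M → M
  x ∧̲ y = proj₁ (lower x y)

module Submission where

open import Defs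
open import Data.Product using (Σ; _×_; _,_; proj₁; proj₂)
open import Function.Base using (id)
open import Function.Bundles using (_⇔_; mk⇔; Equivalence)
open import Relation.Binary.PropositionalEquality
  using (_≡_; refl; sym; trans; cong; cong₂; subst; isEquivalence; module ≡-Reasoning)
open import Relation.Binary.Structures using (IsPartialOrder)

-- Both orders can be read through either operation: x ≤ y iff y ⊔ x = y, and
-- x ⊑ y iff x ⊔ y = y (M2a, M2b).  Antisymmetry is then exactly (M1), and the
-- "absorption" axioms (M3)–(M4) say that ⊔ and ⊓ are monotone in the right
-- mixed sense; monotonicity gives transitivity and shows that x ⊔ y and x ⊓ y
-- are the mixed envelopes.  Conversely, in a mixed lattice every instance of
-- (M2)–(M4) asserts that an element is the envelope of a pair, or is ≤-comparable
-- to it, which the extremal properties of the envelopes provide.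

module AlgebraToOrder {M : Set} {_⊔_ _⊓_ : M → M → M}
                      (A : IsMixedLatticeAlgebra M _⊔_ _⊓_) where
  open IsMixedLatticeAlgebra A
  open ≡-Reasoning

  _≤_ _⊑_ : M → M → Set
  _≤_ = algLe _⊓_
  _⊑_ = algSqLe _⊓_

  ⊓-idem : ∀ x → x ⊓ x ≡ x
  ⊓-idem x = begin
    x ⊓ x               ≡⟨ cong (x ⊓_) (sym (M2a₁ x x)) ⟩
    x ⊓ ((x ⊓ x) ⊔ x)   ≡⟨ M2b₂ x (x ⊓ x) ⟩
    x                   ∎

  ≤⇒⊔ : ∀ {x y} → x ≤ y → y ⊔ x ≡ y
  ≤⇒⊔ {x} {y} x⊓y≡x = trans (cong (y ⊔_) (sym x⊓y≡x)) (M2b₁ y x)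

  ⊔⇒≤ : ∀ {x y} → y ⊔ x ≡ y → x ≤ y
  ⊔⇒≤ {x} {y} y⊔x≡y = trans (cong (x ⊓_) (sym y⊔x≡y)) (M2b₂ x y)

  ⊑⇒⊔ : ∀ {x y} → x ⊑ y → x ⊔ y ≡ y
  ⊑⇒⊔ {x} {y} y⊓x≡x = trans (cong (_⊔ y) (sym y⊓x≡x)) (M2a₁ y x)

  ⊔⇒⊑ : ∀ {x y} → x ⊔ y ≡ y → x ⊑ y
  ⊔⇒⊑ {x} {y} x⊔y≡y = trans (cong (_⊓ x) (sym x⊔y≡y)) (M2a₂ x y)

  ≤-antisym : ∀ {x y} → x ≤ y → y ≤ x → x ≡ y
  ≤-antisym {x} {y} x≤y y≤x = Equivalence.to (M1 x y) (trans (≤⇒⊔ y≤x) (sym x≤y))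

  ⊑-antisym : ∀ {x y} → x ⊑ y → y ⊑ x → x ≡ y
  ⊑-antisym {x} {y} x⊑y y⊑x = Equivalence.to (M1 x y) (trans (⊑⇒⊔ x⊑y) (sym y⊑x))

  ≤-trans : ∀ {x y z} → x ≤ y → y ≤ z → x ≤ z
  ≤-trans {x} {y} {z} x≤y y≤z = begin
    x ⊓ z                         ≡⟨ cong (x ⊓_) (sym (≤⇒⊔ y≤z)) ⟩
    x ⊓ (z ⊔ y)                   ≡⟨ M3a z y x ⟩
    (x ⊓ (z ⊔ y)) ⊔ (x ⊓ y)       ≡⟨ cong₂ (λ a b → (x ⊓ a) ⊔ b) (≤⇒⊔ y≤z) x≤y ⟩
    (x ⊓ z) ⊔ x                   ≡⟨ M2a₁ x z ⟩
    x                             ∎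

  ⊔-monoˡ-⊑-≤ : ∀ {x v} y → x ⊑ v → (x ⊔ y) ≤ (v ⊔ y)
  ⊔-monoˡ-⊑-≤ {x} {v} y x⊑v = sym (begin
    x ⊔ y                         ≡⟨ cong (_⊔ y) (sym x⊑v) ⟩
    (v ⊓ x) ⊔ y                   ≡⟨ M4b v x y ⟩
    ((v ⊓ x) ⊔ y) ⊓ (v ⊔ y)       ≡⟨ cong (λ a → (a ⊔ y) ⊓ (v ⊔ y)) x⊑v ⟩
    (x ⊔ y) ⊓ (v ⊔ y)             ∎)

  ⊓-monoˡ-⊑-≤ : ∀ {v x} y → v ⊑ x → (v ⊓ y) ≤ (x ⊓ y)
  ⊓-monoˡ-⊑-≤ {v} {x} y v⊑x = ⊔⇒≤ (sym (begin
    x ⊓ y                         ≡⟨ cong (_⊓ y) (sym (⊑⇒⊔ v⊑x)) ⟩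
    (v ⊔ x) ⊓ y                   ≡⟨ M4a v x y ⟩
    ((v ⊔ x) ⊓ y) ⊔ (v ⊓ y)       ≡⟨ cong (λ a → (a ⊓ y) ⊔ (v ⊓ y)) (⊑⇒⊔ v⊑x) ⟩
    (x ⊓ y) ⊔ (v ⊓ y)             ∎))

  ⊑-trans : ∀ {x y z} → x ⊑ y → y ⊑ z → x ⊑ z
  ⊑-trans {x} {y} {z} x⊑y y⊑z = ⊔⇒⊑ (≤-antisym x⊔z≤z (M2b₂ z x))
    where
    x⊔z≤z : (x ⊔ z) ≤ z
    x⊔z≤z = subst ((x ⊔ z) ≤_) (⊑⇒⊔ y⊑z) (⊔-monoˡ-⊑-≤ z x⊑y)

  ≤-isPartialOrder : IsPartialOrder _≡_ _≤_
  ≤-isPartialOrder = record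
    { isPreorder = record
      { isEquivalence = isEquivalence
      ; reflexive     = λ { {x} refl → ⊓-idem x }
      ; trans         = ≤-trans
      }
    ; antisym = ≤-antisym
    }

  ⊑-isPartialOrder : IsPartialOrder _≡_ _⊑_
  ⊑-isPartialOrder = record
    { isPreorder = record
      { isEquivalence = isEquivalence
      ; reflexive     = λ { {x} refl → ⊓-idem x }
      ; trans         = ⊑-trans
      }
    ; antisym = ⊑-antisym
    }

  ⊔-isUpperEnvelope : ∀ x y → IsUpperEnvelope _≤_ _⊑_ x y (x ⊔ y)
  ⊔-isUpperEnvelope x y = (M2a₂ x y , M2b₂ y x) , least
    where
    least : ∀ v → x ⊑ v → y ≤ v → (x ⊔ y) ≤ v
    least v x⊑v y≤v = subst ((x ⊔ y) ≤_) (≤⇒⊔ y≤v) (⊔-monoˡ-⊑-≤ y x⊑v)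

  ⊓-isLowerEnvelope : ∀ x y → IsLowerEnvelope _≤_ _⊑_ x y (x ⊓ y)
  ⊓-isLowerEnvelope x y = (⊔⇒⊑ (M2a₁ x y) , ⊔⇒≤ (M2b₁ y x)) , greatest
    where
    greatest : ∀ v → v ⊑ x → v ≤ y → v ≤ (x ⊓ y)
    greatest v v⊑x v≤y = subst (_≤ (x ⊓ y)) v≤y (⊓-monoˡ-⊑-≤ y v⊑x)

  isMixedLattice : IsMixedLattice M _≤_ _⊑_
  isMixedLattice = record
    { ≤-isPartialOrder = ≤-isPartialOrder
    ; ⊑-isPartialOrder = ⊑-isPartialOrder
    ; upper            = λ x y → x ⊔ y , ⊔-isUpperEnvelope x y
    ; lower            = λ x y → x ⊓ y , ⊓-isLowerEnvelope x y
    }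

module OrderToAlgebra {M : Set} {_≤_ _⊑_ : M → M → Set} (ML : IsMixedLattice M _≤_ _⊑_)
  (∨̄-absorbs-≤ : ∀ {x y} → x ≤ y → IsMixedLattice._∨̄_ ML y x ≡ y)
  (∧̲-absorbs-≤ : ∀ {x y} → x ≤ y → IsMixedLattice._∧̲_ ML x y ≡ x) where
  open IsMixedLattice ML
  module ≤ = IsPartialOrder ≤-isPartialOrder
  module ⊑ = IsPartialOrder ⊑-isPartialOrder

  x⊑x∨̄y : ∀ x y → x ⊑ (x ∨̄ y)
  x⊑x∨̄y x y = proj₁ (proj₁ (proj₂ (upper x y)))

  y≤x∨̄y : ∀ x y → y ≤ (x ∨̄ y)
  y≤x∨̄y x y = proj₂ (proj₁ (proj₂ (upper x y)))

  ∨̄-least : ∀ x y v → x ⊑ v → y ≤ v → (x ∨̄ y) ≤ v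
  ∨̄-least x y = proj₂ (proj₂ (upper x y))

  x∧̲y⊑x : ∀ x y → (x ∧̲ y) ⊑ x
  x∧̲y⊑x x y = proj₁ (proj₁ (proj₂ (lower x y)))

  x∧̲y≤y : ∀ x y → (x ∧̲ y) ≤ y
  x∧̲y≤y x y = proj₂ (proj₁ (proj₂ (lower x y)))

  ∧̲-greatest : ∀ x y v → v ⊑ x → v ≤ y → v ≤ (x ∧̲ y)
  ∧̲-greatest x y = proj₂ (proj₂ (lower x y))

  ∨̄-unique : ∀ {x y w} → IsUpperEnvelope _≤_ _⊑_ x y w → x ∨̄ y ≡ w
  ∨̄-unique {x} {y} {w} ((x⊑w , y≤w) , least) =
    ≤.antisym (∨̄-least x y w x⊑w y≤w) (least _ (x⊑x∨̄y x y) (y≤x∨̄y x y))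

  ∧̲-unique : ∀ {x y w} → IsLowerEnvelope _≤_ _⊑_ x y w → x ∧̲ y ≡ w
  ∧̲-unique {x} {y} {w} ((w⊑x , w≤y) , greatest) =
    ≤.antisym (greatest _ (x∧̲y⊑x x y) (x∧̲y≤y x y)) (∧̲-greatest x y w w⊑x w≤y)

  ∨̄≡∧̲⇒≡ : ∀ {x y} → x ∨̄ y ≡ x ∧̲ y → x ≡ y
  ∨̄≡∧̲⇒≡ {x} {y} e = trans (⊑.antisym x⊑x∧̲y (x∧̲y⊑x x y)) (sym (≤.antisym y≤x∧̲y (x∧̲y≤y x y)))
    where
    x⊑x∧̲y : x ⊑ (x ∧̲ y)
    x⊑x∧̲y = subst (x ⊑_) e (x⊑x∨̄y x y)
    y≤x∧̲y : y ≤ (x ∧̲ y)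
    y≤x∧̲y = subst (y ≤_) e (y≤x∨̄y x y)

  ∨̄≡∧̲⇔≡ : ∀ x y → (x ∨̄ y ≡ x ∧̲ y) ⇔ (x ≡ y)
  ∨̄≡∧̲⇔≡ x y = mk⇔ ∨̄≡∧̲⇒≡ λ { refl → trans (∨̄-absorbs-≤ ≤.refl) (sym (∧̲-absorbs-≤ ≤.refl)) }

  isMixedLatticeAlgebra : IsMixedLatticeAlgebra M _∨̄_ _∧̲_
  isMixedLatticeAlgebra = record
    { M1   = ∨̄≡∧̲⇔≡
    ; M2a₁ = λ x y → ∨̄-unique ((x∧̲y⊑x x y , ≤.refl) , λ _ _ x≤v → x≤v)
    ; M2a₂ = λ x y → ∧̲-unique ((x⊑x∨̄y x y , ≤.refl) , λ _ _ v≤x → v≤x)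
    ; M2b₁ = λ x y → ∨̄-absorbs-≤ (x∧̲y≤y y x)
    ; M2b₂ = λ x y → ∧̲-absorbs-≤ (y≤x∨̄y y x)
    ; M3a  = λ x y z → sym (∨̄-absorbs-≤
               (∧̲-greatest z _ _ (x∧̲y⊑x z y) (≤.trans (x∧̲y≤y z y) (y≤x∨̄y x y))))
    ; M3b  = λ x y z → sym (∧̲-absorbs-≤
               (∨̄-least z _ _ (x⊑x∨̄y z y) (≤.trans (x∧̲y≤y x y) (y≤x∨̄y z y))))
    ; M4a  = λ x y z → sym (∨̄-absorbs-≤
               (∧̲-greatest _ z _ (⊑.trans (x∧̲y⊑x x z) (x⊑x∨̄y x y)) (x∧̲y≤y x z)))
    ; M4b  = λ x y z → sym (∧̲-absorbs-≤
               (∨̄-least _ z _ (⊑.trans (x∧̲y⊑x x y) (x⊑x∨̄y x z)) (y≤x∨̄y x z)))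
    }

theorem3p4 : ((M : Set) (_⊔_ _⊓_ : M → M → M) → IsMixedLatticeAlgebra M _⊔_ _⊓_ →
               Σ (IsMixedLattice M (algLe _⊓_) (algSqLe _⊓_)) λ ML →
                 ∀ x y → (algLe _⊓_ x y ⇔ IsMixedLattice._∨̄_ ML y x ≡ y)
                       × (algLe _⊓_ x y ⇔ IsMixedLattice._∧̲_ ML x y ≡ x))
           × ((M : Set) (_≤_ _⊑_ : M → M → Set) (ML : IsMixedLattice M _≤_ _⊑_) →
               (∀ x y → ((x ≤ y) ⇔ IsMixedLattice._∨̄_ ML y x ≡ y)
                      × ((x ≤ y) ⇔ IsMixedLattice._∧̲_ ML x y ≡ x)) →
               IsMixedLatticeAlgebra M (IsMixedLattice._∨̄_ ML) (IsMixedLattice._∧̲_ ML))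
theorem3p4 =
    (λ M _⊔_ _⊓_ A → let open AlgebraToOrder A in
       isMixedLattice , λ x y → mk⇔ ≤⇒⊔ ⊔⇒≤ , mk⇔ id id)
  , (λ M _≤_ _⊑_ ML compatible → OrderToAlgebra.isMixedLatticeAlgebra ML
       (λ {x} {y} → Equivalence.to (proj₁ (compatible x y)))
       (λ {x} {y} → Equivalence.to (proj₂ (compatible x y))))
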